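{- For every integer $k\geq 2$, $\chi_{\star}(\mathcal{M}_{C\langle k,3\rangle}) \geq 2k-2$.
   Context: $C\langle k,3\rangle$ denotes the closure of the rooted complete ternary tree of depth $k$ (each non-leaf node has exactly 3 children; depth is the number of vertices on a root-to-leaf path; the closure of a rooted tree is the graph on its vertex set where two vertices are adjacent iff one is an ancestor of the other). $\mathcal{M}_H$ is the class of graphs not containing $H$ as a minor. A graph is $m$-colourable with clustering $c$ if it has an $m$-colouring in which every connected component of the subgraph induced by each colour class has at most $c$ vertices. The clustered chromatic number $\chi_{\star}(\mathcal{G})$ of a class $\mathcal{G}$ is the minimum $m$ such that for some $c$ every graph in $\mathcal{G}$ is $m$-colourable with clustering $c$. -}

module Defs where

open import Data.Nat using (ℕ; zero; suc; _+_; _≤_; _<_)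
open import Data.Nat.Properties using (m+1+n≢m)
open import Data.Fin using (Fin)
open import Data.List using (List; []; _∷_; _++_; length)
open import Data.List.Properties using (length-++)
open import Data.List.Relation.Unary.All using (All)
open import Data.List.Relation.Unary.Unique.Propositional using (Unique)
open import Data.Maybe using (Maybe; just)
open import Data.Product using (Σ; ∃; ∃-syntax; _×_; _,_; proj₁)
open import Data.Sum using (_⊎_; inj₁; inj₂)
open import Data.Empty using (⊥)
open import Relation.Nullary using (¬_)
open import Relation.Binary.PropositionalEquality using (_≡_; refl; sym; trans; cong)

record Graph (V : Set) : Set₁ where
  field
    Adj    : V → V → Set
    adj-sym    : ∀ {x y} → Adj x y → Adj y x
    adj-irrefl : ∀ {x} → ¬ Adj x x

open Graph public

data WalkIn {V : Set} (G : Graph V) (S : V → Set) : V → V → Set where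
  here : ∀ {x} → S x → WalkIn G S x x
  step : ∀ {x y z} → S x → Adj G x y → WalkIn G S y z → WalkIn G S x z

ConnectedIn : {V : Set} → Graph V → (V → Set) → Set
ConnectedIn G S = ∀ x y → S x → S y → WalkIn G S x y

-- Minors: H is a minor of G iff there is a model of H in G, i.e.
-- pairwise disjoint, nonempty, connected branch sets B_h (h ∈ V(H)),
-- given here by a partial map β : V(G) → V(H) with B_h = β⁻¹(h), such
-- that for every edge hh' of H some edge of G joins B_h and B_h'.

IsMinorOf : {W V : Set} → Graph W → Graph V → Set
IsMinorOf {W} {V} H G =
  Σ (V → Maybe W) λ β →
    (∀ h → ∃[ x ] β x ≡ just h) ×
    (∀ h → ConnectedIn G (λ x → β x ≡ just h)) ×
    (∀ h h' → Adj H h h' →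
       ∃[ x ] ∃[ y ] (β x ≡ just h × β y ≡ just h' × Adj G x y))

-- The component
-- of the colour class of f v containing v is the set of vertices joined
-- to v by a walk all of whose vertices have colour f v; "at most c
-- vertices" = every duplicate-free list of such vertices has length ≤ c.

ColourableWithClustering : {V : Set} → Graph V → ℕ → ℕ → Set
ColourableWithClustering {V} G m c =
  Σ (V → Fin m) λ f →
    ∀ (v : V) (xs : List V) → Unique xs →
      All (λ x → WalkIn G (λ y → f y ≡ f v) v x) xs → length xs ≤ c

-- C⟨k,3⟩: closure of the rooted complete ternary tree of depth k.
-- Vertices are words over Fin 3 of length < k (the root is [], the
-- children of w are w ++ [a]); depth k = k vertices on a root-to-leaf
-- path.  u is a (proper) ancestor of v iff u is a proper prefix of v.

TVertex : ℕ → Set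
TVertex k = Σ (List (Fin 3)) λ w → length w < k

ProperPrefix : List (Fin 3) → List (Fin 3) → Set
ProperPrefix u v = ∃[ a ] ∃[ s ] (u ++ a ∷ s ≡ v)

AncAdj : ∀ {k} → TVertex k → TVertex k → Set
AncAdj (u , _) (v , _) = ProperPrefix u v ⊎ ProperPrefix v u

private
  pp-irrefl : ∀ {u} → ¬ ProperPrefix u u
  pp-irrefl {u} (a , s , eq) =
    m+1+n≢m (length u) (trans (sym (length-++ u {a ∷ s})) (cong length eq))

  anc-irrefl : ∀ {k} {x : TVertex k} → ¬ AncAdj x x
  anc-irrefl (inj₁ p) = pp-irrefl p
  anc-irrefl (inj₂ p) = pp-irrefl p

  anc-sym : ∀ {k} {x y : TVertex k} → AncAdj x y → AncAdj y x
  anc-sym (inj₁ p) = inj₂ p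
  anc-sym (inj₂ p) = inj₁ p

C⟨_,3⟩ : (k : ℕ) → Graph (TVertex k)
C⟨ k ,3⟩ = record { Adj = AncAdj {k} ; adj-sym = λ {x} {y} → anc-sym {k} {x} {y} ; adj-irrefl = λ {x} → anc-irrefl {k} {x} }

-- Fix a clustering bound c and put N = 2c + 1.  For a graph A let ⟨A⟩ be the
-- graph consisting of a path p₀ p₁ … p_N together with, for each of its N
-- edges p_e p_{e+1}, N disjoint copies of A all of whose vertices are joined
-- to both p_e and p_{e+1}.  Starting from the empty graph and iterating gives
-- graphs G₀, G₁, G₂, …, and the theorem is witnessed by G_{k−1}:
--
-- If C⟨j+1,3⟩ is no minor of A, then C⟨j+2,3⟩ is no minor of ⟨A⟩.
--    In a model, the vertices under each of the three children of the root
--    form connected disjoint sets, any two of them joined through the branch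
--    set of the root.  They cannot all meet the path: the middle one along the
--    path would separate the other two.  A set missing the path lies inside
--    one copy of A and yields a model of C⟨j+1,3⟩ there.
--  * Colourings.  If A has no m-colouring with clustering c, then ⟨A⟩ has no
--    (m+2)-colouring with clustering c.  The path has N + 1 > c vertices, so
--    some edge p_e p_{e+1} has two colours α ≠ β; at most c of its copies see
--    α and at most c see β, so one copy avoids both and is m-coloured.
--  * Finally the graphs are relabelled to live on Fin n, as the theorem asks.
module Submission where

open import Defs
open import Data.Nat using (ℕ; zero; suc; _+_; _≤_; _<_; _*_; _∸_; z≤n; s≤s)
open import Data.Nat.Properties
  using (<-cmp; <-irrefl; <-asym; <-trans; <⇒≤; <⇒≱; ≤-refl; ≤-reflexive; ≤-pred; n<1+n;
         +-suc; +-mono-≤; m≤m+n; m≤n⇒m≤1+n; ≤-irrelevant)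
open import Data.Fin using (Fin; zero; suc; toℕ; inject₁; inject≤; punchOut)
open import Data.Fin.Properties
  using (toℕ-injective; toℕ-inject₁; inject≤-injective; punchOut-injective; any?; all?;
         ¬∀⟶∃¬; _≟_; +↔⊎; *↔×)
open import Data.Fin.Induction using (<-weakInduction)
open import Data.Fin.Patterns using (0F; 1F; 2F)
open import Data.List using (List; []; _∷_; length; map; filter; allFin)
open import Data.List.Properties using (length-map; length-tabulate)
open import Data.List.Relation.Unary.All as All using (All; []; _∷_)
open import Data.List.Relation.Unary.All.Properties using (all-filter) renaming (map⁺ to All-map⁺)
open import Data.List.Relation.Unary.Unique.Propositional using (Unique)
open import Data.List.Relation.Unary.Unique.Propositional.Properties
  using (allFin⁺) renaming (map⁺ to Unique-map⁺; filter⁺ to Unique-filter⁺)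
open import Data.Maybe using (Maybe; just; nothing)
open import Data.Maybe.Properties using (≡-dec)
open import Data.Product using (Σ; ∃; ∃-syntax; _×_; _,_; proj₁; proj₂)
open import Data.Product.Function.NonDependent.Propositional using (_×-↔_)
open import Data.Sum using (_⊎_; inj₁; inj₂)
open import Data.Sum.Function.Propositional using (_⊎-↔_)
open import Data.Bool using (true; false; if_then_else_)
open import Data.Empty using (⊥; ⊥-elim)
open import Function using (_∘_)
open import Function.Bundles using (_↔_; Inverse; mk↔ₛ′)
open import Function.Properties.Inverse using (↔-refl; ↔-sym; ↔-trans)
open import Relation.Nullary using (¬_; Dec; yes; no; does)
open import Relation.Nullary.Decidable using (¬?; _⊎-dec_; map′; decidable-stable)
open import Relation.Unary using (Decidable)
open import Relation.Unary.Properties using (∁?)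
open import Relation.Binary.Definitions using (tri<; tri≈; tri>)
open import Relation.Binary.PropositionalEquality
  using (_≡_; _≢_; refl; sym; trans; cong; subst; subst₂)

module _ {V : Set} {G : Graph V} where

  firstʷ : ∀ {S x y} → WalkIn G S x y → S x
  firstʷ (here s)     = s
  firstʷ (step s _ _) = s

  lastʷ : ∀ {S x y} → WalkIn G S x y → S y
  lastʷ (here s)     = s
  lastʷ (step _ _ w) = lastʷ w

  _++ʷ_ : ∀ {S x y z} → WalkIn G S x y → WalkIn G S y z → WalkIn G S x z
  here _     ++ʷ w′ = w′
  step s a w ++ʷ w′ = step s a (w ++ʷ w′)

  snocʷ : ∀ {S x y z} → WalkIn G S x y → Adj G y z → S z → WalkIn G S x z
  snocʷ (here s)     a sz = step s a (here sz)
  snocʷ (step s a w) b sz = step s a (snocʷ w b sz)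

  reverseʷ : ∀ {S x y} → WalkIn G S x y → WalkIn G S y x
  reverseʷ (here s)     = here s
  reverseʷ (step s a w) = snocʷ (reverseʷ w) (adj-sym G a) s

  weakenʷ : ∀ {S T : V → Set} → (∀ {v} → S v → T v) →
            ∀ {x y} → WalkIn G S x y → WalkIn G T x y
  weakenʷ f (here s)     = here (f s)
  weakenʷ f (step s a w) = step (f s) a (weakenʷ f w)

Homomorphism : {V W : Set} → Graph V → Graph W → (V → W) → Set
Homomorphism G H φ = ∀ {x y} → Adj G x y → Adj H (φ x) (φ y)

mapʷ : ∀ {V W} {G : Graph V} {H : Graph W} {φ : V → W} {S : W → Set} →
       Homomorphism G H φ → ∀ {x y} → WalkIn G (S ∘ φ) x y → WalkIn H S (φ x) (φ y)
mapʷ hom (here s)     = here s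
mapʷ hom (step s a w) = step s (hom a) (mapʷ hom w)

Clustered : {V : Set} → Graph V → {m : ℕ} → (V → Fin m) → ℕ → Set
Clustered {V} G f c =
  ∀ (v : V) (xs : List V) → Unique xs →
    All (λ x → WalkIn G (λ y → f y ≡ f v) v x) xs → length xs ≤ c

clustered-pullback :
  ∀ {V W} {G : Graph V} {H : Graph W} {m m′ c} (φ : V → W) →
  Homomorphism G H φ → (∀ {x y} → φ x ≡ φ y → x ≡ y) →
  (f : W → Fin m) → Clustered H f c →
  (g : V → Fin m′) → (∀ {x y} → g x ≡ g y → f (φ x) ≡ f (φ y)) → Clustered G g c
clustered-pullback {c = c} φ hom φ-inj f f-cl g g-sep v xs xs-unique walks =
  subst (_≤ c) (length-map φ xs)
    (f-cl (φ v) (map φ xs) (Unique-map⁺ φ-inj xs-unique)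
      (All-map⁺ (All.map (mapʷ hom ∘ weakenʷ g-sep) walks)))

colourable-mono : ∀ {V} {G : Graph V} {m M c} → m ≤ M →
                  ColourableWithClustering G m c → ColourableWithClustering G M c
colourable-mono m≤M (f , f-cl) =
  (λ v → inject≤ (f v) m≤M) ,
  clustered-pullback (λ v → v) (λ a → a) (λ eq → eq) f f-cl _ (inject≤-injective m≤M m≤M _ _)

same-colour-neighbours : ∀ {V} {G : Graph V} {m c} {f : V → Fin m} → Clustered G f c →
  ∀ v xs → Unique xs → All (λ x → Adj G v x × f x ≡ f v) xs → length xs ≤ c
same-colour-neighbours f-cl v xs xs-unique nbrs =
  f-cl v xs xs-unique (All.map (λ (a , eq) → step refl a (here eq)) nbrs)

-- Deleting two distinct colours α, β from Fin (2 + m) leaves an injective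
-- renaming of the other colours into Fin m.
module _ {m : ℕ} {α β : Fin (suc (suc m))} (α≢β : α ≢ β) where

  squeeze : (γ : Fin (suc (suc m))) → α ≢ γ → β ≢ γ → Fin m
  squeeze γ α≢γ β≢γ =
    punchOut {i = punchOut α≢β} {j = punchOut α≢γ} (β≢γ ∘ punchOut-injective α≢β α≢γ)

  squeeze-injective : ∀ {γ δ} (α≢γ : α ≢ γ) (β≢γ : β ≢ γ)
                      (α≢δ : α ≢ δ) (β≢δ : β ≢ δ) →
                      squeeze γ α≢γ β≢γ ≡ squeeze δ α≢δ β≢δ → γ ≡ δ
  squeeze-injective α≢γ β≢γ α≢δ β≢δ eq =
    punchOut-injective α≢γ α≢δ
      (punchOut-injective (β≢γ ∘ punchOut-injective α≢β α≢γ)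
                          (β≢δ ∘ punchOut-injective α≢β α≢δ) eq)

length-filter-split : ∀ {X : Set} {P : X → Set} (P? : Decidable P) (xs : List X) →
  length (filter P? xs) + length (filter (∁? P?) xs) ≡ length xs
length-filter-split P? [] = refl
length-filter-split P? (x ∷ xs) with does (P? x)
... | true  = cong suc (length-filter-split P? xs)
... | false = trans (+-suc _ _) (cong suc (length-filter-split P? xs))

Finite : Set → Set
Finite V = Σ ℕ λ n → V ↔ Fin n

any?-finite : ∀ {V} → Finite V → {P : V → Set} → Decidable P → Dec (∃ P)
any?-finite (n , e) {P} P? =
  map′ (λ (i , p) → from i , p)
       (λ (x , p) → to x , subst P (sym (strictlyInverseʳ x)) p)
       (any? (P? ∘ from))
  where open Inverse e

data ExtVertex (N : ℕ) (V : Set) : Set where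
  path : Fin (suc N) → ExtVertex N V
  copy : (e q : Fin N) → V → ExtVertex N V   -- q-th copy of A on path edge e

Incident : ∀ {N} → Fin (suc N) → Fin N → Set
Incident i e = toℕ i ≡ toℕ e ⊎ toℕ i ≡ suc (toℕ e)

data ExtAdj {N : ℕ} {V : Set} (A : Graph V) : ExtVertex N V → ExtVertex N V → Set where
  path-next : ∀ {i j} → suc (toℕ i) ≡ toℕ j → ExtAdj A (path i) (path j)
  path-prev : ∀ {i j} → toℕ i ≡ suc (toℕ j) → ExtAdj A (path i) (path j)
  path-copy : ∀ {i e q x} → Incident i e → ExtAdj A (path i) (copy e q x)
  copy-path : ∀ {i e q x} → Incident i e → ExtAdj A (copy e q x) (path i)
  copy-copy : ∀ {e q x y} → Adj A x y → ExtAdj A (copy e q x) (copy e q y)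

extend : (N : ℕ) → {V : Set} → Graph V → Graph (ExtVertex N V)
extend N A = record { Adj = ExtAdj A ; adj-sym = symmetric ; adj-irrefl = irreflexive }
  where
    symmetric : ∀ {x y} → ExtAdj A x y → ExtAdj A y x
    symmetric (path-next eq) = path-prev (sym eq)
    symmetric (path-prev eq) = path-next (sym eq)
    symmetric (path-copy i)  = copy-path i
    symmetric (copy-path i)  = path-copy i
    symmetric (copy-copy a)  = copy-copy (adj-sym A a)

    irreflexive : ∀ {x} → ¬ ExtAdj A x x
    irreflexive (path-next eq) = <-irrefl (sym eq) ≤-refl
    irreflexive (path-prev eq) = <-irrefl eq ≤-refl
    irreflexive (copy-copy a)  = adj-irrefl A a

extend-finite : ∀ N {V} → Finite V → Finite (ExtVertex N V)
extend-finite N (n , e) =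
  suc N + N * (N * n) ,
  ↔-trans as-sum
    (↔-trans (↔-refl ⊎-↔ (↔-refl ×-↔ (↔-refl ×-↔ e)))
      (↔-trans (↔-refl ⊎-↔ (↔-refl ×-↔ ↔-sym *↔×))
        (↔-trans (↔-refl ⊎-↔ ↔-sym *↔×) (↔-sym +↔⊎))))
  where
    as-sum : ∀ {V} → ExtVertex N V ↔ (Fin (suc N) ⊎ Fin N × Fin N × V)
    as-sum = mk↔ₛ′
      (λ { (path i) → inj₁ i ; (copy e q x) → inj₂ (e , q , x) })
      (λ { (inj₁ i) → path i ; (inj₂ (e , q , x)) → copy e q x })
      (λ { (inj₁ i) → refl ; (inj₂ _) → refl })
      (λ { (path i) → refl ; (copy _ _ _) → refl })

module ExtWalks {N : ℕ} {V : Set} (A : Graph V) where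

  B : Graph (ExtVertex N V)
  B = extend N A

  Before : ℕ → ExtVertex N V → Set
  Before l (path i)     = toℕ i < l
  Before l (copy e _ _) = toℕ e < l

  After : ℕ → ExtVertex N V → Set
  After l (path i)     = l < toℕ i
  After l (copy e _ _) = l ≤ toℕ e

  trichotomy : ∀ l v → Before l v ⊎ (∃[ i ] (v ≡ path i × toℕ i ≡ l)) ⊎ After l v
  trichotomy l (path i) with <-cmp (toℕ i) l
  ... | tri< lt _ _ = inj₁ lt
  ... | tri≈ _ eq _ = inj₂ (inj₁ (i , refl , eq))
  ... | tri> _ _ gt = inj₂ (inj₂ gt)
  trichotomy l (copy e _ _) with <-cmp (toℕ e) l
  ... | tri< lt _ _ = inj₁ lt
  ... | tri≈ _ eq _ = inj₂ (inj₂ (≤-reflexive (sym eq)))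
  ... | tri> _ _ gt = inj₂ (inj₂ (<⇒≤ gt))

  not-before-and-after : ∀ l v → Before l v → After l v → ⊥
  not-before-and-after l (path i)     b a = <-asym b a
  not-before-and-after l (copy e _ _) b a = <⇒≱ b a

  no-edge-across : ∀ l {u v} → ExtAdj A u v → Before l u → After l v → ⊥
  no-edge-across l (path-next eq)       b a = <⇒≱ b (≤-pred (subst (l <_) (sym eq) a))
  no-edge-across l (path-prev eq)       b a = <-asym a (<-trans (≤-reflexive (sym eq)) b)
  no-edge-across l (path-copy (inj₁ eq)) b a = <⇒≱ (subst (_< l) eq b) a
  no-edge-across l (path-copy (inj₂ eq)) b a = <⇒≱ (<-trans (n<1+n _) (subst (_< l) eq b)) a
  no-edge-across l (copy-path (inj₁ eq)) b a = <-asym b (subst (l <_) eq a)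
  no-edge-across l (copy-path (inj₂ eq)) b a = <⇒≱ (subst (l <_) eq a) b
  no-edge-across l (copy-copy _)        b a = <⇒≱ b a

  crossing : ∀ l {S u w} → WalkIn B S u w → Before l u → After l w →
             ∃[ i ] (toℕ i ≡ l × S (path i))
  crossing l {u = u} (here _) b a = ⊥-elim (not-before-and-after l u b a)
  crossing l (step {y = y} _ adj rest) b a with trichotomy l y
  ... | inj₁ b′                     = crossing l rest b′ a
  ... | inj₂ (inj₁ (i , refl , eq)) = i , eq , firstʷ rest
  ... | inj₂ (inj₂ a′)              = ⊥-elim (no-edge-across l adj b a′)

  stays-in-copy : ∀ {S e q x v} → WalkIn B S (copy e q x) v → (∀ i → ¬ S (path i)) →
                  ∃[ x′ ] (v ≡ copy e q x′ × WalkIn A (λ z → S (copy e q z)) x x′)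
  stays-in-copy (here s) off = _ , refl , here s
  stays-in-copy (step {y = path i} _ _ rest) off = ⊥-elim (off i (firstʷ rest))
  stays-in-copy (step {y = copy _ _ _} s (copy-copy a) rest) off
    with stays-in-copy rest off
  ... | x′ , eq , w = x′ , eq , step s a w

first-letter : ∀ {k} → Maybe (TVertex k) → Maybe (Fin 3)
first-letter (just (a ∷ _ , _)) = just a
first-letter _                  = nothing

first-letter-inv : ∀ {k} (t : Maybe (TVertex k)) a → first-letter t ≡ just a →
                   ∃[ w ] ∃[ lt ] (t ≡ just (a ∷ w , lt))
first-letter-inv (just (b ∷ w , lt)) a refl = w , lt , refl

subtree-adjacency : ∀ {k} a {w w′ : List (Fin 3)}
                    (lt : length w < suc k) (lt′ : length w′ < suc k) →
                    AncAdj {suc k} (w , lt) (w′ , lt′) →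
                    AncAdj {suc (suc k)} (a ∷ w , s≤s lt) (a ∷ w′ , s≤s lt′)
subtree-adjacency a lt lt′ (inj₁ (b , s , eq)) = inj₁ (b , s , cong (a ∷_) eq)
subtree-adjacency a lt lt′ (inj₂ (b , s , eq)) = inj₂ (b , s , cong (a ∷_) eq)

descend : ∀ {k} → Fin 3 → Maybe (TVertex (suc (suc k))) → Maybe (TVertex (suc k))
descend a (just (b ∷ w , s≤s lt)) = if does (b ≟ a) then just (w , lt) else nothing
descend a _                       = nothing

descend-child : ∀ {k} a w (lt : length w < suc k) →
                descend a (just (a ∷ w , s≤s lt)) ≡ just (w , lt)
descend-child a w lt with a ≟ a
... | yes _  = refl
... | no a≢a = ⊥-elim (a≢a refl)

descend-inv : ∀ {k} a (t : Maybe (TVertex (suc (suc k)))) w (lt : length w < suc k) →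
              descend a t ≡ just (w , lt) → t ≡ just (a ∷ w , s≤s lt)
descend-inv a (just (b ∷ w′ , s≤s lt′)) w lt eq with b ≟ a
descend-inv a (just (b ∷ w′ , s≤s lt′)) w lt refl | yes refl = refl

module Subtrees {V : Set} {G : Graph V} {j : ℕ} (β : V → Maybe (TVertex (suc (suc j))))
  (nonempty  : ∀ h → ∃[ x ] β x ≡ just h)
  (connected : ∀ h → ConnectedIn G (λ x → β x ≡ just h))
  (adjacent  : ∀ h h′ → Adj C⟨ suc (suc j) ,3⟩ h h′ →
                 ∃[ x ] ∃[ y ] (β x ≡ just h × β y ≡ just h′ × Adj G x y)) where

  root : TVertex (suc (suc j))
  root = [] , s≤s z≤n

  child : Fin 3 → TVertex (suc (suc j))
  child a = a ∷ [] , s≤s (s≤s z≤n)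

  Root : V → Set
  Root v = β v ≡ just root

  -- v lies in the branch set of a vertex of the subtree below child a.
  Under : Fin 3 → V → Set
  Under a v = first-letter (β v) ≡ just a

  hub : Fin 3 → V
  hub a = proj₁ (nonempty (child a))

  hub-child : ∀ a → β (hub a) ≡ just (child a)
  hub-child a = proj₂ (nonempty (child a))

  in-branch-set : ∀ {a v} → β v ≡ just (child a) → Under a v
  in-branch-set = cong first-letter

  -- Every vertex under a reaches hub a within the subtree; in the closure every
  -- vertex of the subtree is adjacent to the child a itself.
  to-hub : ∀ a v → Under a v → WalkIn G (Under a) v (hub a)
  to-hub a v u with first-letter-inv (β v) a u
  ... | [] , lt , eq rewrite ≤-irrelevant lt (s≤s (s≤s z≤n)) =
    weakenʷ in-branch-set (connected (child a) v (hub a) eq (hub-child a))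
  ... | b ∷ s , lt , eq with adjacent (child a) (a ∷ b ∷ s , lt) (inj₁ (b , s , refl))
  ...   | x , y , βx , βy , xy =
    weakenʷ (cong first-letter) (connected _ v y eq βy) ++ʷ
      step (cong first-letter βy) (adj-sym G xy)
        (weakenʷ in-branch-set (connected (child a) x (hub a) βx (hub-child a)))

  under-connected : ∀ a → ConnectedIn G (Under a)
  under-connected a u v uu uv = to-hub a u uu ++ʷ reverseʷ (to-hub a v uv)

  under-disjoint : ∀ {a b v} → Under a v → Under b v → a ≡ b
  under-disjoint ua ub with trans (sym ua) ub
  ... | refl = refl

  root-not-under : ∀ {a v} → Root v → ¬ Under a v
  root-not-under r u with trans (sym (cong first-letter r)) u
  ... | ()

  through-root : ∀ {a c u v} → Under a u → Under c v →
                 WalkIn G (λ x → Under a x ⊎ Root x ⊎ Under c x) u v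
  through-root {a} {c} {u} {v} ua uc
    with adjacent root (child a) (inj₁ (a , [] , refl))
       | adjacent root (child c) (inj₁ (c , [] , refl))
  ... | ra , xa , βra , βxa , ra-xa | rc , xc , βrc , βxc , rc-xc =
    weakenʷ inj₁ (under-connected a u xa ua (in-branch-set βxa)) ++ʷ
    step (inj₁ (in-branch-set βxa)) (adj-sym G ra-xa)
      (weakenʷ (inj₂ ∘ inj₁) (connected root ra rc βra βrc) ++ʷ
       step (inj₂ (inj₁ βrc)) rc-xc
         (weakenʷ (inj₂ ∘ inj₂) (under-connected c xc v (in-branch-set βxc) uc)))

middle-of-three : (p : Fin 3 → ℕ) → (∀ a b → p a ≡ p b → a ≡ b) →
                  ∃[ a ] ∃[ b ] ∃[ c ] (p a < p b × p b < p c)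
middle-of-three p distinct
  with <-cmp (p 0F) (p 1F) | <-cmp (p 1F) (p 2F) | <-cmp (p 0F) (p 2F)
... | tri≈ _ eq _ | _ | _ with () ← distinct 0F 1F eq
... | _ | tri≈ _ eq _ | _ with () ← distinct 1F 2F eq
... | _ | _ | tri≈ _ eq _ with () ← distinct 0F 2F eq
... | tri< 0<1 _ _ | tri< 1<2 _ _ | _            = 0F , 1F , 2F , 0<1 , 1<2
... | tri< 0<1 _ _ | tri> _ _ 2<1 | tri< 0<2 _ _ = 0F , 2F , 1F , 0<2 , 2<1
... | tri< 0<1 _ _ | tri> _ _ 2<1 | tri> _ _ 2<0 = 2F , 0F , 1F , 2<0 , 0<1
... | tri> _ _ 1<0 | tri< 1<2 _ _ | tri< 0<2 _ _ = 1F , 0F , 2F , 1<0 , 0<2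
... | tri> _ _ 1<0 | tri< 1<2 _ _ | tri> _ _ 2<0 = 1F , 2F , 0F , 1<2 , 2<0
... | tri> _ _ 1<0 | tri> _ _ 2<1 | _            = 2F , 1F , 0F , 2<1 , 1<0

module ExtMinor (N : ℕ) {V : Set} (A : Graph V) {j : ℕ}
  (β : ExtVertex N V → Maybe (TVertex (suc (suc j))))
  (nonempty  : ∀ h → ∃[ x ] β x ≡ just h)
  (connected : ∀ h → ConnectedIn (extend N A) (λ x → β x ≡ just h))
  (adjacent  : ∀ h h′ → Adj C⟨ suc (suc j) ,3⟩ h h′ →
                 ∃[ x ] ∃[ y ] (β x ≡ just h × β y ≡ just h′ × Adj (extend N A) x y)) where

  open ExtWalks {N} A
  open Subtrees β nonempty connected adjacent

  OnPath : Fin 3 → Set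
  OnPath a = ∃[ i ] Under a (path i)

  -- The three subtrees do not all meet the path: the middle one would
  -- separate the other two.
  not-all-on-path : (p : Fin 3 → Fin (suc N)) → (∀ a → Under a (path (p a))) → ⊥
  not-all-on-path p on
    with middle-of-three (toℕ ∘ p)
           (λ a b eq → under-disjoint (subst (Under a ∘ path) (toℕ-injective eq) (on a)) (on b))
  ... | a , b , c , a<b , b<c
    with crossing (toℕ (p b)) (through-root (on a) (on c)) a<b b<c
  ... | i , eq , meets with toℕ-injective eq
  ... | refl with meets
  ...   | inj₁ ua        = <-irrefl (cong (toℕ ∘ p) (under-disjoint ua (on b))) a<b
  ...   | inj₂ (inj₁ r)  = root-not-under r (on b)
  ...   | inj₂ (inj₂ uc) = <-irrefl (cong (toℕ ∘ p) (under-disjoint (on b) uc)) b<c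

  on-path? : ∀ a → Dec (OnPath a)
  on-path? a = any? (λ i → ≡-dec _≟_ (first-letter (β (path i))) (just a))

  some-subtree-off-path : ∃[ a ] ¬ OnPath a
  some-subtree-off-path with on-path? 0F | on-path? 1F | on-path? 2F
  ... | yes (i₀ , u₀) | yes (i₁ , u₁) | yes (i₂ , u₂) = ⊥-elim
    (not-all-on-path (λ { 0F → i₀ ; 1F → i₁ ; 2F → i₂ }) (λ { 0F → u₀ ; 1F → u₁ ; 2F → u₂ }))
  ... | no off | _ | _ = 0F , off
  ... | _ | no off | _ = 1F , off
  ... | _ | _ | no off = 2F , off

  -- If the subtree below a misses the path and contains a vertex of the copy
  -- (e, q), it lies entirely in that copy, and stripping the letter a gives a
  -- model of C⟨j+1,3⟩ in A.
  module Stripped (a : Fin 3) (off : ¬ OnPath a) (e q : Fin N) (x₀ : V)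
                  (u₀ : Under a (copy e q x₀)) where

    avoids : ∀ i → ¬ Under a (path i)
    avoids i u = off (i , u)

    inside : ∀ v → Under a v → ∃[ x ] (v ≡ copy e q x)
    inside v u with stays-in-copy (under-connected a _ v u₀ u) avoids
    ... | x , eq , _ = x , eq

    β′ : V → Maybe (TVertex (suc j))
    β′ x = descend a (β (copy e q x))

    β′-child : ∀ {x w lt} → β (copy e q x) ≡ just (a ∷ w , s≤s lt) → β′ x ≡ just (w , lt)
    β′-child {w = w} {lt} eq = trans (cong (descend a) eq) (descend-child a w lt)

    nonempty′ : ∀ h → ∃[ x ] β′ x ≡ just h
    nonempty′ (w , lt) with nonempty (a ∷ w , s≤s lt)
    ... | v , βv with inside v (cong first-letter βv)
    ... | x , refl = x , β′-child βv

    connected′ : ∀ h → ConnectedIn A (λ x → β′ x ≡ just h)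
    connected′ (w , lt) x y βx βy
      with stays-in-copy (connected _ (copy e q x) (copy e q y)
                            (descend-inv a _ w lt βx) (descend-inv a _ w lt βy))
                         (λ i → avoids i ∘ cong first-letter)
    ... | _ , refl , walk = weakenʷ β′-child walk

    adjacent′ : ∀ h h′ → Adj C⟨ suc j ,3⟩ h h′ →
                ∃[ x ] ∃[ y ] (β′ x ≡ just h × β′ y ≡ just h′ × Adj A x y)
    adjacent′ (w , lt) (w′ , lt′) hh′
      with adjacent _ _ (subtree-adjacency a lt lt′ hh′)
    ... | v , v′ , βv , βv′ , vv′
      with inside v (cong first-letter βv) | inside v′ (cong first-letter βv′)
    ... | x , refl | y , refl with vv′
    ... | copy-copy xy = x , y , β′-child βv , β′-child βv′ , xy

    model : IsMinorOf C⟨ suc j ,3⟩ A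
    model = β′ , nonempty′ , connected′ , adjacent′

  -- The subtree missing the path meets some copy (its child's branch set is
  -- nonempty and off the path), so it yields a model in A.
  descended-model : IsMinorOf C⟨ suc j ,3⟩ A
  descended-model with some-subtree-off-path
  ... | a , off = from-hub (hub a) (in-branch-set (hub-child a))
    where
      from-hub : ∀ v → Under a v → IsMinorOf C⟨ suc j ,3⟩ A
      from-hub (path i)      u = ⊥-elim (off (i , u))
      from-hub (copy e q x₀) u = Stripped.model a off e q x₀ u

extend-minor-free : ∀ N {V} (A : Graph V) {j} →
                    ¬ IsMinorOf C⟨ suc j ,3⟩ A → ¬ IsMinorOf C⟨ suc (suc j) ,3⟩ (extend N A)
extend-minor-free N A A-free (β , nonempty , connected , adjacent) =
  A-free (ExtMinor.descended-model N A β nonempty connected adjacent)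

module ExtColouring (c : ℕ) {V : Set} (A : Graph V) where

  N : ℕ
  N = suc (c + c)

  open ExtWalks {N} A using (B)

  left right : Fin N → ExtVertex N V
  left  e = path (inject₁ e)
  right e = path (suc e)

  left-incident : ∀ (e : Fin N) → Incident (inject₁ e) e
  left-incident e = inj₁ (toℕ-inject₁ e)

  right-incident : ∀ (e : Fin N) → Incident (suc e) e
  right-incident e = inj₂ refl

  module _ {M : ℕ} (f : ExtVertex N V → Fin M) (f-cl : Clustered B f c) where

    -- The path has N + 1 > c vertices, so it is not monochromatic.
    bichromatic-edge : ∃[ e ] f (left e) ≢ f (right e)
    bichromatic-edge with all? (λ e → f (left e) ≟ f (right e))
    ... | no not-mono = ¬∀⟶∃¬ N _ (λ e → f (left e) ≟ f (right e)) not-mono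
    ... | yes mono = ⊥-elim (<⇒≱ (s≤s (m≤n⇒m≤1+n (m≤m+n c c))) too-big)
      where
        walk-along : ∀ i → WalkIn B (λ y → f y ≡ f (path 0F)) (path 0F) (path i)
        walk-along = <-weakInduction _ (here refl)
          (λ e w → snocʷ w (path-next (cong suc (toℕ-inject₁ e))) (trans (sym (mono e)) (lastʷ w)))

        too-big : suc N ≤ c
        too-big = subst (_≤ c) (trans (length-map path (allFin (suc N))) (length-tabulate (λ i → i)))
          (f-cl (path 0F) (map path (allFin (suc N)))
            (Unique-map⁺ (λ { refl → refl }) (allFin⁺ (suc N)))
            (All-map⁺ (All.tabulate {xs = allFin (suc N)} (λ {i} _ → walk-along i))))

    Hit : Fin N → Fin N → Set
    Hit e q = ∃[ x ] (f (copy e q x) ≡ f (left e) ⊎ f (copy e q x) ≡ f (right e))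

    hit? : Finite V → ∀ e q → Dec (Hit e q)
    hit? finV e q =
      any?-finite finV (λ x → (f (copy e q x) ≟ f (left e)) ⊎-dec (f (copy e q x) ≟ f (right e)))

    -- Not every copy on edge e contains an end colour: each copy containing the
    -- colour of an end gives a neighbour of that end of the same colour, so at
    -- most c copies do so for each of the two ends, while there are 2c + 1.
    not-all-hit : ∀ e → (∀ q → Hit e q) → ⊥
    not-all-hit e hit = <-irrefl refl (subst (_≤ c + c) counted (+-mono-≤ left-bound right-bound))
      where
        witness : Fin N → ExtVertex N V
        witness q = copy e q (proj₁ (hit q))

        witness-injective : ∀ {q q′} → witness q ≡ witness q′ → q ≡ q′
        witness-injective refl = refl

        Left? : Decidable (λ q → f (witness q) ≡ f (left e))
        Left? q = f (witness q) ≟ f (left e)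

        on-left on-right : List (Fin N)
        on-left  = filter Left? (allFin N)
        on-right = filter (∁? Left?) (allFin N)

        counted : length on-left + length on-right ≡ N
        counted = trans (length-filter-split Left? (allFin N)) (length-tabulate (λ i → i))

        left-bound : length on-left ≤ c
        left-bound = subst (_≤ c) (length-map witness on-left)
          (same-colour-neighbours f-cl (left e) (map witness on-left)
            (Unique-map⁺ witness-injective (Unique-filter⁺ Left? (allFin⁺ N)))
            (All-map⁺ (All.map (λ eq → path-copy (left-incident e) , eq)
                               (all-filter Left? (allFin N)))))

        right-colour : ∀ {q} → ¬ f (witness q) ≡ f (left e) →
                       Adj B (right e) (witness q) × f (witness q) ≡ f (right e)
        right-colour {q} not-left with proj₂ (hit q)
        ... | inj₁ eq = ⊥-elim (not-left eq)
        ... | inj₂ eq = path-copy (right-incident e) , eq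

        right-bound : length on-right ≤ c
        right-bound = subst (_≤ c) (length-map witness on-right)
          (same-colour-neighbours f-cl (right e) (map witness on-right)
            (Unique-map⁺ witness-injective (Unique-filter⁺ (∁? Left?) (allFin⁺ N)))
            (All-map⁺ (All.map right-colour (all-filter (∁? Left?) (allFin N)))))

    avoiding-copy : Finite V → ∀ e → ∃[ q ] ¬ Hit e q
    avoiding-copy finV e with any? (λ q → ¬? (hit? finV e q))
    ... | yes found = found
    ... | no none   =
      ⊥-elim (not-all-hit e (λ q → decidable-stable (hit? finV e q) (λ miss → none (q , miss))))

  -- An (m+2)-colouring of ⟨A⟩ with clustering c restricts to an m-colouring
  -- of A with clustering c on a copy avoiding the colours of a bichromatic edge.
  restrict : Finite V → ∀ {m} → ColourableWithClustering B (suc (suc m)) c →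
             ColourableWithClustering A m c
  restrict finV {m} (f , f-cl) with bichromatic-edge f f-cl
  ... | e , α≢β with avoiding-copy f f-cl finV e
  ... | q , avoids =
    g , clustered-pullback (copy e q) copy-copy (λ { refl → refl }) f f-cl g
          (λ {x} {y} → squeeze-injective α≢β (not-α x) (not-β x) (not-α y) (not-β y))
    where
      not-α : ∀ x → f (left e) ≢ f (copy e q x)
      not-α x eq = avoids (x , inj₁ (sym eq))

      not-β : ∀ x → f (right e) ≢ f (copy e q x)
      not-β x eq = avoids (x , inj₂ (sym eq))

      g : V → Fin m
      g x = squeeze α≢β (f (copy e q x)) (not-α x) (not-β x)

  -- The path alone needs two colours.
  not-one-colourable : ¬ ColourableWithClustering B 1 c
  not-one-colourable (f , f-cl) with bichromatic-edge f f-cl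
  ... | e , α≢β with f (left e) | f (right e)
  ... | 0F | 0F = α≢β refl

module Relabel {V : Set} (G : Graph V) {n : ℕ} (e : V ↔ Fin n) where
  open Inverse e

  relabelled : Graph (Fin n)
  relabelled = record
    { Adj = λ i j → Adj G (from i) (from j) ; adj-sym = adj-sym G ; adj-irrefl = adj-irrefl G }

  -- from : Fin n → V is by definition a homomorphism relabelled → G (and to
  -- one back), so models and colourings transport along the bijection.
  minor-back : ∀ {W} {H : Graph W} → IsMinorOf H relabelled → IsMinorOf H G
  minor-back (β , nonempty , connected , adjacent) =
    β ∘ to ,
    (λ h → let (i , βi) = nonempty h in from i , trans (cong β (strictlyInverseˡ i)) βi) ,
    (λ h u v βu βv →
       subst₂ (WalkIn G _) (strictlyInverseʳ u) (strictlyInverseʳ v)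
         (mapʷ (λ a → a)
           (weakenʷ (λ {i} βi → trans (cong β (strictlyInverseˡ i)) βi)
             (connected h (to u) (to v) βu βv)))) ,
    (λ h h′ hh′ → let (i , i′ , βi , βi′ , ii′) = adjacent h h′ hh′ in
       from i , from i′ , trans (cong β (strictlyInverseˡ i)) βi ,
       trans (cong β (strictlyInverseˡ i′)) βi′ , ii′)

  colouring-back : ∀ {m c} → ColourableWithClustering relabelled m c →
                   ColourableWithClustering G m c
  colouring-back (f , f-cl) =
    f ∘ to ,
    clustered-pullback to
      (λ {x} {y} → subst₂ (Adj G) (sym (strictlyInverseʳ x)) (sym (strictlyInverseʳ y)))
      (λ {x} {y} eq → trans (sym (strictlyInverseʳ x)) (trans (cong from eq) (strictlyInverseʳ y)))
      f f-cl (f ∘ to) (λ eq → eq)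

TowerVertex : ℕ → ℕ → Set
TowerVertex N zero    = ⊥
TowerVertex N (suc j) = ExtVertex N (TowerVertex N j)

tower : (N j : ℕ) → Graph (TowerVertex N j)
tower N zero    = record { Adj = λ () ; adj-sym = λ { {()} } ; adj-irrefl = λ { {()} } }
tower N (suc j) = extend N (tower N j)

tower-finite : ∀ N j → Finite (TowerVertex N j)
tower-finite N zero    = 0 , mk↔ₛ′ (λ ()) (λ ()) (λ ()) (λ ())
tower-finite N (suc j) = extend-finite N (tower-finite N j)

tower-minor-free : ∀ N j → ¬ IsMinorOf C⟨ suc j ,3⟩ (tower N j)
tower-minor-free N zero (_ , nonempty , _) = proj₁ (nonempty ([] , s≤s z≤n))
tower-minor-free N (suc j) = extend-minor-free N (tower N j) (tower-minor-free N j)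

-- 2j + 1, the number of colours that do not suffice for G_{j+1}.
colours : ℕ → ℕ
colours zero    = 1
colours (suc j) = suc (suc (colours j))

tower-not-colourable : ∀ c j →
  ¬ ColourableWithClustering (tower (suc (c + c)) (suc j)) (colours j) c
tower-not-colourable c zero = ExtColouring.not-one-colourable c (tower _ zero)
tower-not-colourable c (suc j) col =
  tower-not-colourable c j
    (ExtColouring.restrict c (tower _ (suc j)) (tower-finite _ (suc j)) col)

-- For k = k′ + 2 colours below 2k − 2 are at most colours k′ = 2k′ + 1.
excluded-colours : ∀ k′ → 2 * suc (suc k′) ∸ 2 ≡ suc (colours k′)
excluded-colours zero     = refl
excluded-colours (suc k′) = cong suc (trans (+-suc k′ _) (cong suc (excluded-colours k′)))

lemma13 : (k : ℕ) → 2 ≤ k → (m : ℕ) → m < 2 * k ∸ 2 → (c : ℕ) →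
    Σ ℕ λ n → Σ (Graph (Fin n)) λ G →
    ¬ IsMinorOf C⟨ k ,3⟩ G × ¬ ColourableWithClustering G m c
lemma13 (suc (suc k′)) (s≤s (s≤s z≤n)) m m<2k−2 c =
  n , relabelled ,
  (λ minor → tower-minor-free N (suc k′) (minor-back {H = C⟨ suc (suc k′) ,3⟩} minor)) ,
  (λ col → tower-not-colourable c k′ (colourable-mono m≤colours (colouring-back col)))
  where
    N : ℕ
    N = suc (c + c)

    m≤colours : m ≤ colours k′
    m≤colours = ≤-pred (subst (m <_) (excluded-colours k′) m<2k−2)

    n : ℕ
    n = proj₁ (tower-finite N (suc k′))
    open Relabel (tower N (suc k′)) (proj₂ (tower-finite N (suc k′)))
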